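{- The fixed points in $\mathcal{M}^{+}_{\mathbb{Z}}$ of the action of $\Gamma$ are exactly \[ \begin{pmatrix} 2 & 2 & 2\\ 2 & 2 & 2\end{pmatrix},\qquad \begin{pmatrix} 4 & 1 & 2\\ 1 & 4 & 2\end{pmatrix}, \] and their permutations.
   Context: $\mathcal{M}^{+}_{\mathbb{Z}}$ is the set of $2\times 3$ arrays $\begin{pmatrix} x & y & z\\ x' & y' & z'\end{pmatrix}$ of positive integers with $xyz=x'y'z'$. $\Gamma$ is the group generated by $\gamma_1(M)=\begin{pmatrix} y'z'-x & y & z\\ yz-x' & y' & z'\end{pmatrix}$, $\gamma_2(M)=\begin{pmatrix} x & z'x'-y & z\\ x' & zx-y' & z'\end{pmatrix}$, $\gamma_3(M)=\begin{pmatrix} x & y & x'y'-z\\ x' & y' & xy-z'\end{pmatrix}$. A permutation of $M$ is any array obtained from $M$ by permuting its three columns and/or swapping its two rows. -}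

module Defs where

open import Data.Integer using (ℤ; +_; _+_; _*_; _-_; _>_)
open import Data.Fin using (Fin; zero; suc)
open import Data.Fin.Permutation using (Permutation′; _⟨$⟩ʳ_)
open import Data.List using (List; []; _∷_)
open import Data.Product using (Σ; ∃; _×_; _,_)
open import Relation.Binary.PropositionalEquality using (_≡_)

record Arr : Set where
  constructor arr
  field
    x y z x' y' z' : ℤ
open Arr public

-- entry i j : row i (0 = top, 1 = bottom), column j
entry : Arr → Fin 2 → Fin 3 → ℤ
entry M zero    zero             = x M
entry M zero    (suc zero)       = y M
entry M zero    (suc (suc zero)) = z M
entry M (suc zero) zero             = x' M
entry M (suc zero) (suc zero)       = y' M
entry M (suc zero) (suc (suc zero)) = z' M

InMplus : Arr → Set
InMplus M = (x M > + 0) × (y M > + 0) × (z M > + 0)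
          × (x' M > + 0) × (y' M > + 0) × (z' M > + 0)
          × (x M * y M * z M ≡ x' M * y' M * z' M)

γ₁ γ₂ γ₃ : Arr → Arr
γ₁ (arr x y z x' y' z') = arr (y' * z' - x) y z (y * z - x') y' z'
γ₂ (arr x y z x' y' z') = arr x (z' * x' - y) z x' (z * x - y') z'
γ₃ (arr x y z x' y' z') = arr x y (x' * y' - z) x' y' (x * y - z')

γ : Fin 3 → Arr → Arr
γ zero             = γ₁
γ (suc zero)       = γ₂
γ (suc (suc zero)) = γ₃

-- action of a word in the generators (each γᵢ is an involution, so every
-- element of Γ is represented by such a word)
act : List (Fin 3) → Arr → Arr
act []      M = M
act (i ∷ w) M = γ i (act w M)

Fixed : Arr → Set
Fixed M = (w : List (Fin 3)) → act w M ≡ M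

IsPermOf : Arr → Arr → Set
IsPermOf M N = Σ (Permutation′ 2) λ τ → Σ (Permutation′ 3) λ π →
  (i : Fin 2) (j : Fin 3) → entry M i j ≡ entry N (τ ⟨$⟩ʳ i) (π ⟨$⟩ʳ j)

A₂₂₂ : Arr
A₂₂₂ = arr (+ 2) (+ 2) (+ 2) (+ 2) (+ 2) (+ 2)

A₄₁₂ : Arr
A₄₁₂ = arr (+ 4) (+ 1) (+ 2) (+ 1) (+ 4) (+ 2)

{-# OPTIONS --safe #-}
module Submission where

-- Fixing the entry x by γ₁ means y'z' = 2x, and likewise for the other five entries.
-- Then x·xyz = (zx)(xy) = 4y'z' = 8x, so xyz = 8 and symmetrically x'y'z' = 8 (only
-- x, x' > 0 is needed to cancel). All entries are therefore at most 8, and a finite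
-- search shows that up to a column permutation only the two listed arrays solve the
-- equations. Conversely, these two arrays satisfy the equations in every relabelling
-- of their rows and columns, hence so does every permutation of them.

open import Defs
open import Data.Sum using (_⊎_; inj₁; inj₂; [_,_]′)
open import Data.Product using (_×_; _,_)
open import Data.Nat as ℕ using (ℕ; _+_; _*_; _≤_; _<_; s≤s; NonZero; >-nonZero)
import Data.Nat.Properties as ℕ
open import Data.Nat.Divisibility using (∣-trans; ∣⇒≤; m∣m*n; n∣m*n; n∣m*n*o)
import Data.Nat.Tactic.RingSolver as ℕ-Solver
open import Data.Integer as ℤ using (+_; +<+)
import Data.Integer.Properties as ℤ
import Data.Integer.Tactic.RingSolver as ℤ-Solver
open import Data.Fin using (Fin)
open import Data.Fin.Patterns using (0F; 1F; 2F)
import Data.Fin.Properties as Fin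
open import Data.Fin.Permutation using (Permutation′; _⟨$⟩ʳ_; id; transpose; _∘ₚ_)
open import Data.List using (List; []; _∷_)
open import Data.List.Relation.Unary.Any using (Any; any?; satisfied)
open import Function using (_∘_; Injection)
open import Function.Properties.Inverse using (↔⇒↣)
open import Relation.Nullary using (Dec; ¬?)
open import Relation.Nullary.Decidable using (map′; toWitness; _×-dec_; _⊎-dec_; _→-dec_)
open import Relation.Binary.PropositionalEquality

fixed-by-generators : ∀ {M} → γ₁ M ≡ M → γ₂ M ≡ M → γ₃ M ≡ M → Fixed M
fixed-by-generators f₁ f₂ f₃ []       = refl
fixed-by-generators f₁ f₂ f₃ (0F ∷ w) rewrite fixed-by-generators f₁ f₂ f₃ w = f₁
fixed-by-generators f₁ f₂ f₃ (1F ∷ w) rewrite fixed-by-generators f₁ f₂ f₃ w = f₂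
fixed-by-generators f₁ f₂ f₃ (2F ∷ w) rewrite fixed-by-generators f₁ f₂ f₃ w = f₃

m*n-o≡o⇒m*n≡2*o : ∀ m n o → + m ℤ.* + n ℤ.- + o ≡ + o → m * n ≡ 2 * o
m*n-o≡o⇒m*n≡2*o m n o eq = ℤ.+-injective (begin
  + (m * n)                      ≡⟨ ℤ.pos-* m n ⟩
  + m ℤ.* + n                    ≡⟨ i≡i-j+j (+ m ℤ.* + n) (+ o) ⟩
  (+ m ℤ.* + n ℤ.- + o) ℤ.+ + o  ≡⟨ cong (ℤ._+ + o) eq ⟩
  + (o + o)                      ≡⟨ cong +_ (ℕ-Solver.solve (o ∷ [])) ⟩
  + (2 * o)                      ∎)
  where
  open ≡-Reasoning
  i≡i-j+j : ∀ i j → i ≡ i ℤ.- j ℤ.+ j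
  i≡i-j+j = ℤ-Solver.solve-∀

record FixedPointEquations (a b c a' b' c' : ℕ) : Set where
  constructor fixedPointEquations
  field
    b'c'≡2a : b' * c' ≡ 2 * a
    c'a'≡2b : c' * a' ≡ 2 * b
    a'b'≡2c : a' * b' ≡ 2 * c
    bc≡2a'  : b * c ≡ 2 * a'
    ca≡2b'  : c * a ≡ 2 * b'
    ab≡2c'  : a * b ≡ 2 * c'

fixedPointEquations? : ∀ a b c a' b' c' → Dec (FixedPointEquations a b c a' b' c')
fixedPointEquations? a b c a' b' c' = map′
  (λ (e₁ , e₂ , e₃ , e₄ , e₅ , e₆) → fixedPointEquations e₁ e₂ e₃ e₄ e₅ e₆)
  (λ (fixedPointEquations e₁ e₂ e₃ e₄ e₅ e₆) → e₁ , e₂ , e₃ , e₄ , e₅ , e₆)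
  ((b' * c' ℕ.≟ 2 * a) ×-dec (c' * a' ℕ.≟ 2 * b) ×-dec (a' * b' ℕ.≟ 2 * c) ×-dec
   (b * c ℕ.≟ 2 * a') ×-dec (c * a ℕ.≟ 2 * b') ×-dec (a * b ℕ.≟ 2 * c'))

fixedPointEquations-swap : ∀ {a b c a' b' c'} →
  FixedPointEquations a b c a' b' c' → FixedPointEquations a' b' c' a b c
fixedPointEquations-swap (fixedPointEquations e₁ e₂ e₃ e₄ e₅ e₆) =
  fixedPointEquations e₄ e₅ e₆ e₁ e₂ e₃

fixed⇒fixedPointEquations : ∀ {a b c a' b' c'} →
  Fixed (arr (+ a) (+ b) (+ c) (+ a') (+ b') (+ c')) → FixedPointEquations a b c a' b' c'
fixed⇒fixedPointEquations {a} {b} {c} {a'} {b'} {c'} F = fixedPointEquations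
  (m*n-o≡o⇒m*n≡2*o b' c' a  (cong x  (F (0F ∷ []))))
  (m*n-o≡o⇒m*n≡2*o c' a' b  (cong y  (F (1F ∷ []))))
  (m*n-o≡o⇒m*n≡2*o a' b' c  (cong z  (F (2F ∷ []))))
  (m*n-o≡o⇒m*n≡2*o b  c  a' (cong x' (F (0F ∷ []))))
  (m*n-o≡o⇒m*n≡2*o c  a  b' (cong y' (F (1F ∷ []))))
  (m*n-o≡o⇒m*n≡2*o a  b  c' (cong z' (F (2F ∷ []))))

fixedPointEquations⇒product≡8 : ∀ {a b c a' b' c'} .{{_ : NonZero a}} →
  FixedPointEquations a b c a' b' c' → a * b * c ≡ 8
fixedPointEquations⇒product≡8 {a} {b} {c} {a'} {b'} {c'} (fixedPointEquations e₁ _ _ _ e₅ e₆) =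
  ℕ.*-cancelˡ-≡ (a * b * c) 8 a (begin
    a * (a * b * c)        ≡⟨ ℕ-Solver.solve (a ∷ b ∷ c ∷ []) ⟩
    (c * a) * (a * b)      ≡⟨ cong₂ _*_ e₅ e₆ ⟩
    (2 * b') * (2 * c')    ≡⟨ ℕ-Solver.solve (b' ∷ c' ∷ []) ⟩
    4 * (b' * c')          ≡⟨ cong (4 *_) e₁ ⟩
    4 * (2 * a)            ≡⟨ ℕ-Solver.solve (a ∷ []) ⟩
    a * 8                  ∎)
  where open ≡-Reasoning

factors≤product : ∀ {a b c n} .{{_ : NonZero n}} → a * b * c ≡ n → a ≤ n × b ≤ n × c ≤ n
factors≤product {a} {b} {c} refl =
  ∣⇒≤ (∣-trans (m∣m*n b) (m∣m*n c)) , ∣⇒≤ (n∣m*n*o a c) , ∣⇒≤ (n∣m*n (a * b))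

permutations₃ : List (Permutation′ 3)
permutations₃ = id ∷ transpose 0F 1F ∷ transpose 0F 2F ∷ transpose 1F 2F
              ∷ transpose 0F 1F ∘ₚ transpose 1F 2F ∷ transpose 1F 2F ∘ₚ transpose 0F 1F ∷ []

ColumnPermOf : Arr → Arr → Set
ColumnPermOf M N = Any (λ π → ∀ i j → entry M i j ≡ entry N i (π ⟨$⟩ʳ j)) permutations₃

columnPermOf? : ∀ M N → Dec (ColumnPermOf M N)
columnPermOf? M N = any? (λ π → Fin.all? λ i → Fin.all? λ j → entry M i j ℤ.≟ entry N i (π ⟨$⟩ʳ j))
                         permutations₃

columnPermOf⇒isPermOf : ∀ {M N} → ColumnPermOf M N → IsPermOf M N
columnPermOf⇒isPermOf p with satisfied p
... | π , e = id , π , e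

Classified : Arr → Set
Classified M = ColumnPermOf M A₂₂₂ ⊎ ColumnPermOf M A₄₁₂

classified? : ∀ M → Dec (Classified M)
classified? M = columnPermOf? M A₂₂₂ ⊎-dec columnPermOf? M A₄₁₂

classified⇒isPermOf : ∀ {M} → Classified M → IsPermOf M A₂₂₂ ⊎ IsPermOf M A₄₁₂
classified⇒isPermOf = [ inj₁ ∘ columnPermOf⇒isPermOf , inj₂ ∘ columnPermOf⇒isPermOf ]′

-- Testing the product before quantifying over the bottom row keeps the search at 10 · 9³ cases.
classified-below-9 : ∀ {a} → a < 9 → ∀ {b} → b < 9 → ∀ {c} → c < 9 → a * b * c ≡ 8 →
  ∀ {a'} → a' < 9 → ∀ {b'} → b' < 9 → ∀ {c'} → c' < 9 → FixedPointEquations a b c a' b' c' →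
  Classified (arr (+ a) (+ b) (+ c) (+ a') (+ b') (+ c'))
classified-below-9 = toWitness {a? =
  below-9? λ a → below-9? λ b → below-9? λ c → (a * b * c ℕ.≟ 8) →-dec
  below-9? λ a' → below-9? λ b' → below-9? λ c' → fixedPointEquations? a b c a' b' c' →-dec
  classified? (arr (+ a) (+ b) (+ c) (+ a') (+ b') (+ c'))} _
  where
  below-9? : ∀ {P : ℕ → Set} → (∀ n → Dec (P n)) → Dec (∀ {n} → n < 9 → P n)
  below-9? P? = ℕ.allUpTo? P? 9

products≡8⇒classified : ∀ {a b c a' b' c'} → a * b * c ≡ 8 → a' * b' * c' ≡ 8 →
  FixedPointEquations a b c a' b' c' → Classified (arr (+ a) (+ b) (+ c) (+ a') (+ b') (+ c'))
products≡8⇒classified abc≡8 a'b'c'≡8 =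
  let a≤8  , b≤8  , c≤8  = factors≤product abc≡8
      a'≤8 , b'≤8 , c'≤8 = factors≤product a'b'c'≡8
  in classified-below-9 (s≤s a≤8) (s≤s b≤8) (s≤s c≤8) abc≡8 (s≤s a'≤8) (s≤s b'≤8) (s≤s c'≤8)

fixed⇒classified : ∀ M → InMplus M → Fixed M → Classified M
fixed⇒classified (arr (+ a) (+ b) (+ c) (+ a') (+ b') (+ c'))
                 (+<+ 0<a , +<+ _ , +<+ _ , +<+ 0<a' , +<+ _ , +<+ _ , _) F =
  products≡8⇒classified
    (fixedPointEquations⇒product≡8 {{>-nonZero 0<a}} eqs)
    (fixedPointEquations⇒product≡8 {{>-nonZero 0<a'}} (fixedPointEquations-swap eqs))
    eqs
  where
  eqs : FixedPointEquations a b c a' b' c'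
  eqs = fixed⇒fixedPointEquations F

-- Unlike γᵢ M ≡ M, this form of the fixed-point equations is invariant under permutations.
FixedUnderRelabelling : Arr → Set
FixedUnderRelabelling N = ∀ (r r' : Fin 2) (j k l : Fin 3) → r ≢ r' → j ≢ k → j ≢ l → k ≢ l →
  entry N r' k ℤ.* entry N r' l ℤ.- entry N r j ≡ entry N r j

fixedUnderRelabelling? : ∀ N → Dec (FixedUnderRelabelling N)
fixedUnderRelabelling? N =
  Fin.all? λ r → Fin.all? λ r' → Fin.all? λ j → Fin.all? λ k → Fin.all? λ l →
  ¬? (r Fin.≟ r') →-dec ¬? (j Fin.≟ k) →-dec ¬? (j Fin.≟ l) →-dec ¬? (k Fin.≟ l) →-dec
  (entry N r' k ℤ.* entry N r' l ℤ.- entry N r j ℤ.≟ entry N r j)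

fixedUnderRelabelling-A₂₂₂ : FixedUnderRelabelling A₂₂₂
fixedUnderRelabelling-A₂₂₂ = toWitness {a? = fixedUnderRelabelling? A₂₂₂} _

fixedUnderRelabelling-A₄₁₂ : FixedUnderRelabelling A₄₁₂
fixedUnderRelabelling-A₄₁₂ = toWitness {a? = fixedUnderRelabelling? A₄₁₂} _

fixedUnderRelabelling-perm : ∀ {M N} → FixedUnderRelabelling N → IsPermOf M N →
  FixedUnderRelabelling M
fixedUnderRelabelling-perm fix (τ , π , e) r r' j k l r≢r' j≢k j≢l k≢l
  rewrite e r j | e r' k | e r' l =
  fix (τ ⟨$⟩ʳ r) (τ ⟨$⟩ʳ r') (π ⟨$⟩ʳ j) (π ⟨$⟩ʳ k) (π ⟨$⟩ʳ l)
      (r≢r' ∘ injective τ) (j≢k ∘ injective π) (j≢l ∘ injective π) (k≢l ∘ injective π)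
  where
  injective : ∀ {n} (σ : Permutation′ n) {i i'} → σ ⟨$⟩ʳ i ≡ σ ⟨$⟩ʳ i' → i ≡ i'
  injective σ = Injection.injective (↔⇒↣ σ)

fixedUnderRelabelling⇒fixed : ∀ {M} → FixedUnderRelabelling M → Fixed M
fixedUnderRelabelling⇒fixed {arr a b c a' b' c'} fix = fixed-by-generators
  (cong₂ (λ u v → arr u b c v b' c') (fix 0F 1F 0F 1F 2F (λ ()) (λ ()) (λ ()) (λ ()))
                                      (fix 1F 0F 0F 1F 2F (λ ()) (λ ()) (λ ()) (λ ())))
  (cong₂ (λ u v → arr a u c a' v c') (fix 0F 1F 1F 2F 0F (λ ()) (λ ()) (λ ()) (λ ()))
                                      (fix 1F 0F 1F 2F 0F (λ ()) (λ ()) (λ ()) (λ ())))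
  (cong₂ (λ u v → arr a b u a' b' v) (fix 0F 1F 2F 0F 1F (λ ()) (λ ()) (λ ()) (λ ()))
                                      (fix 1F 0F 2F 0F 1F (λ ()) (λ ()) (λ ()) (λ ())))

proposition9p9 : (M : Arr) → InMplus M →
    (Fixed M → IsPermOf M A₂₂₂ ⊎ IsPermOf M A₄₁₂) × (IsPermOf M A₂₂₂ ⊎ IsPermOf M A₄₁₂ → Fixed M)
proposition9p9 M M⁺ =
  classified⇒isPermOf ∘ fixed⇒classified M M⁺ ,
  [ fixedUnderRelabelling⇒fixed ∘ fixedUnderRelabelling-perm fixedUnderRelabelling-A₂₂₂
  , fixedUnderRelabelling⇒fixed ∘ fixedUnderRelabelling-perm fixedUnderRelabelling-A₄₁₂ ]′
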